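{- For every integer $b \geqslant 2$, one has $\ell(b) = (b-1)\beta(b)$.
   Context: For an integer $b\geqslant 2$ and a set $S\subseteq [0,b-1]=\{0,1,\dots,b-1\}$, the Kempner set $\mathcal{K}(S,b)$ is the set of non-negative integers whose base-$b$ expansions use only digits from $S$. A set $S$ is called permitted if $0\in S$ and $S\neq[0,b-1]$; then $\mathcal{K}(S,b)$ is called a proper Kempner set. $\ell(b)$ denotes the length (number of terms) of the longest arithmetic progression (with nonzero common difference) contained in some proper Kempner set of base $b$. For a positive integer $n$, $\rho(n)$ is the product of the distinct primes dividing $n$, and $\beta(b)$ is the largest positive integer $m<b$ such that $\rho(m)\mid b$ (equivalently, the largest integer less than $b$ dividing some power of $b$). -}

module Defs where

open import Data.Nat using (ℕ; zero; suc; _+_; _*_; _∸_; _≤_; _<_; NonZero)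
open import Data.Nat.DivMod using (_/_; _%_; m%n<n)
open import Data.Nat.Divisibility using (_∣_; _∣?_)
open import Data.Nat.Primality using (Prime; prime?)
open import Data.Fin using (Fin; toℕ; fromℕ<)
open import Data.Fin.Subset using (Subset; _∈_; _∉_)
open import Data.List using (List; filter; upTo)
open import Data.Nat.ListAction using (product)
open import Data.Product using (Σ; ∃; ∃-syntax; _×_; _,_)
open import Relation.Nullary using (yes; no)
open import Relation.Nullary.Decidable using (_×-dec_)
open import Relation.Binary.PropositionalEquality using (_≡_)

rho : ℕ → ℕ
rho n = product (filter (λ p → prime? p ×-dec (p ∣? n)) (upTo (suc n)))

betaUpTo : ℕ → ℕ → ℕ
betaUpTo b zero = zero
betaUpTo b (suc k) with rho (suc k) ∣? b
... | yes _ = suc k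
... | no  _ = betaUpTo b k

beta : ℕ → ℕ
beta b = betaUpTo b (b ∸ 1)

shift : (b : ℕ) .{{_ : NonZero b}} → ℕ → ℕ → ℕ
shift b n zero = n
shift b n (suc k) = shift b n k / b

digit : (b : ℕ) .{{_ : NonZero b}} → ℕ → ℕ → Fin b
digit b n k = fromℕ< (m%n<n (shift b n k) b)

InKempner : (b : ℕ) .{{_ : NonZero b}} → Subset b → ℕ → Set
InKempner b S n = ∀ k → digit b n k ∈ S

Permitted : (b : ℕ) → Subset b → Set
Permitted b S = (Σ (Fin b) λ z → toℕ z ≡ 0 × z ∈ S) × (Σ (Fin b) λ d → d ∉ S)

HasAP : (b : ℕ) .{{_ : NonZero b}} → Subset b → ℕ → Set
HasAP b S L = ∃[ a ] ∃[ d ] (0 < d × (∀ i → i < L → InKempner b S (a + i * d)))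

IsEll : (b : ℕ) .{{_ : NonZero b}} → ℕ → Set
IsEll b L =
  (Σ (Subset b) λ S → Permitted b S × HasAP b S L) ×
  (∀ (S : Subset b) (m : ℕ) → Permitted b S → HasAP b S m → m ≤ L)

{-# OPTIONS --safe #-}
-- Lower bound: β = β(b) divides some b^k, and the multiples i·(b^k/β), i < (b−1)β, never use the
-- digit b−1: their digits above position k are those of i/β < b−1, and each lower digit has the
-- form ⌊u·b/β⌋ mod b, which is at most b−2 because β < b.
--
-- Upper bound: let a + i·d avoid the digit c, and let q_J be the additive order of d modulo
-- b^(J+1). Then q_J ∣ b^(J+1), q_0 ≤ b, q_(J+1) ≤ b·q_J and q_d ≥ b. At the first level J with
-- q_J ≥ b, either J = 0, or q_(J−1) < b divides a power of b and so is ≤ β; either way q_J ≤ bβ.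
-- Modulo M = b^(J+1) the first q_J terms are distinct and lie on the grid r + k·g (k < q_J) with
-- g = M/q_J. The residues whose J-th digit is c form a block of length b^J, which contains
-- w = ⌊b^J/g⌋ ≥ ⌊q_J/b⌋ consecutive grid points, so the progression has at most
-- q_J − ⌊q_J/b⌋ ≤ (b−1)β terms.
module Submission where

open import Defs
open import Data.Nat
open import Data.Nat.Properties
open import Data.Nat.Divisibility
open import Data.Nat.DivMod
open import Data.Nat.Primality using (Prime; prime?; euclidsLemma; ¬prime[1])
open import Data.Nat.Primality.Factorisation using (factorise; factorisationHasAllPrimeFactors; module PrimeFactorisation)
open import Data.Nat.ListAction using (product)
open import Data.Nat.ListAction.Properties using (∈⇒∣product)
open import Data.Nat.Solver using (module +-*-Solver)
open import Data.List using (List; _∷_; filter; upTo; length)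
open import Data.List.Membership.Propositional using () renaming (_∈_ to _∈ₗ_)
open import Data.List.Membership.Propositional.Properties using (∈-filter⁺; ∈-upTo⁺)
open import Data.List.Relation.Unary.All as All using (All; []; _∷_)
open import Data.List.Relation.Unary.All.Properties using (all-filter)
open import Data.List.Relation.Unary.AllPairs using (AllPairs; []; _∷_)
import Data.List.Relation.Unary.AllPairs.Properties as AllPairs
open import Data.Fin as Fin using (Fin; toℕ; fromℕ<)
open import Data.Fin.Properties using (toℕ-fromℕ<; toℕ-injective; toℕ<n; pigeonhole)
open import Data.Fin.Subset using (Subset; _∈_; _∉_; ∁; ⁅_⁆)
open import Data.Fin.Subset.Properties using (x≢y⇒x∉⁅y⁆; x∉p⇒x∈∁p; x∈p⇒x∉∁p; x∈⁅x⁆)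
open import Data.Product using (∃; ∃₂; ∃-syntax; _×_; _,_; proj₁; proj₂)
open import Data.Sum using (_⊎_; inj₁; inj₂)
open import Function using (_∘_)
open import Relation.Nullary using (¬_; yes; no; contradiction)
open import Relation.Nullary.Decidable using (_×-dec_)
open import Relation.Unary using (Decidable)
open import Relation.Binary.PropositionalEquality
open +-*-Solver

least-witness : {P : ℕ → Set} → Decidable P → ∀ {n} → P n →
                ∃[ m ] P m × (∀ {k} → k < m → ¬ P k)
least-witness P? {zero} p = 0 , p , λ ()
least-witness {P} P? {suc n} p with P? 0
... | yes p0 = 0 , p0 , λ ()
... | no ¬p0 with least-witness (P? ∘ suc) p
...   | m , pm , below = suc m , pm , below′
  where
  below′ : ∀ {k} → k < suc m → ¬ P k
  below′ {zero}  _         = ¬p0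
  below′ {suc k} (s<s k<m) = below k<m

first-crossing : {Q : ℕ → Set} → Decidable Q → ¬ Q 0 → ∀ {n} → Q n →
                 ∃[ j ] ¬ Q j × Q (suc j)
first-crossing Q? ¬q0 {zero}  q = contradiction q ¬q0
first-crossing Q? ¬q0 {suc n} q with Q? n
... | yes qn = first-crossing Q? ¬q0 qn
... | no ¬qn = n , ¬qn , q

n<m^n : ∀ {m} → 1 < m → ∀ n → n < m ^ n
n<m^n 1<m zero    = z<s
n<m^n {m@(suc _)} 1<m (suc n) = begin-strict
  suc n           ≤⟨ n<m^n 1<m n ⟩
  m ^ n           <⟨ m<m*n (m ^ n) m ⦃ m^n≢0 m n ⦄ 1<m ⟩
  m ^ n * m       ≡⟨ *-comm (m ^ n) m ⟩
  m ^ suc n       ∎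
  where open ≤-Reasoning

%≡%⇒∣∸ : ∀ {x y} M .{{_ : NonZero M}} → x % M ≡ y % M → M ∣ y ∸ x
%≡%⇒∣∸ {x} {y} M eq = divides (y / M ∸ x / M) (begin
  y ∸ x                                     ≡⟨ cong₂ _∸_ (m≡m%n+[m/n]*n y M) (m≡m%n+[m/n]*n x M) ⟩
  (y % M + y / M * M) ∸ (x % M + x / M * M) ≡⟨ cong (λ z → (y % M + y / M * M) ∸ (z + x / M * M)) eq ⟩
  (y % M + y / M * M) ∸ (y % M + x / M * M) ≡⟨ [m+n]∸[m+o]≡n∸o (y % M) (y / M * M) (x / M * M) ⟩
  y / M * M ∸ x / M * M                     ≡⟨ *-distribʳ-∸ M (y / M) (x / M) ⟨
  (y / M ∸ x / M) * M                       ∎)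
  where open ≡-Reasoning

c*n≤m<c*n+n⇒m/n≡c : ∀ {m n} c .{{_ : NonZero n}} → c * n ≤ m → m < c * n + n → m / n ≡ c
c*n≤m<c*n+n⇒m/n≡c {m} {n} c lo hi = begin
  m / n                         ≡⟨ cong (_/ n) (m+[n∸m]≡n lo) ⟨
  (c * n + (m ∸ c * n)) / n     ≡⟨ +-distrib-/-∣ˡ (m ∸ c * n) (n∣m*n c) ⟩
  c * n / n + (m ∸ c * n) / n   ≡⟨ cong₂ _+_ (m*n/n≡m c n) (m<n⇒m/n≡0 rest<n) ⟩
  c + 0                         ≡⟨ +-identityʳ c ⟩
  c                             ∎
  where
  open ≡-Reasoning
  rest<n : m ∸ c * n < n
  rest<n = +-cancelˡ-< (c * n) _ _ (subst (_< c * n + n) (sym (m+[n∸m]≡n lo)) hi)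

m≤n*o⇒m∸m/n≤[n∸1]*o : ∀ m n o .{{_ : NonZero n}} → m ≤ n * o → m ∸ m / n ≤ (n ∸ 1) * o
m≤n*o⇒m∸m/n≤[n∸1]*o m n@(suc n′) o m≤no with m / n <? o
... | no u≮o = begin
  m ∸ m / n     ≤⟨ ∸-monoʳ-≤ m (≮⇒≥ u≮o) ⟩
  m ∸ o         ≤⟨ ∸-monoˡ-≤ o m≤no ⟩
  n * o ∸ o     ≡⟨ m+n∸m≡n o (n′ * o) ⟩
  n′ * o        ∎
  where open ≤-Reasoning
... | yes u<o = begin
  m ∸ u                       ≡⟨ cong (_∸ u) m≡ ⟩
  (m % n + u * n′) + u ∸ u    ≡⟨ m+n∸n≡m _ u ⟩
  m % n + u * n′              ≤⟨ +-monoˡ-≤ (u * n′) (s≤s⁻¹ (m%n<n m n)) ⟩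
  suc u * n′                  ≤⟨ *-monoˡ-≤ n′ u<o ⟩
  o * n′                      ≡⟨ *-comm o n′ ⟩
  n′ * o                      ∎
  where
  open ≤-Reasoning
  u = m / n
  m≡ : m ≡ (m % n + u * n′) + u
  m≡ = trans (m≡m%n+[m/n]*n m n)
         (solve 3 (λ r u n′ → r :+ u :* (con 1 :+ n′) := (r :+ u :* n′) :+ u) refl (m % n) u n′)

*n/m%n<n∸1 : ∀ u {m n} .{{_ : NonZero m}} .{{_ : NonZero n}} → m < n → u * n / m % n < n ∸ 1
*n/m%n<n∸1 u {m} {n@(suc n′)} m<n = subst (_< n′) (sym u*n/m%n≡x) x<n′
  where
  z = u % m
  x = z * n / m
  z*n<n′*m : z * n < n′ * m
  z*n<n′*m = +-cancelʳ-< n _ _ (begin-strict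
    z * n + n    ≡⟨ +-comm (z * n) n ⟩
    suc z * n    ≤⟨ *-monoˡ-≤ n (m%n<n u m) ⟩
    m * n        ≡⟨ solve 2 (λ m n′ → m :* (con 1 :+ n′) := n′ :* m :+ m) refl m n′ ⟩
    n′ * m + m   <⟨ +-monoʳ-< (n′ * m) m<n ⟩
    n′ * m + n   ∎)
    where open ≤-Reasoning
  x<n′ : x < n′
  x<n′ = m<n*o⇒m/o<n z*n<n′*m
  u*n≡ : u * n ≡ z * n + (u / m * n) * m
  u*n≡ = trans (cong (_* n) (m≡m%n+[m/n]*n u m))
           (solve 4 (λ z q m n → (z :+ q :* m) :* n := z :* n :+ (q :* n) :* m) refl z (u / m) m n)
  u*n/m%n≡x : u * n / m % n ≡ x
  u*n/m%n≡x = begin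
    u * n / m % n                         ≡⟨ cong (λ t → t / m % n) u*n≡ ⟩
    (z * n + (u / m * n) * m) / m % n     ≡⟨ cong (_% n) (+-distrib-/-∣ʳ (z * n) (n∣m*n (u / m * n))) ⟩
    (x + (u / m * n) * m / m) % n         ≡⟨ cong (λ t → (x + t) % n) (m*n/n≡m (u / m * n) m) ⟩
    (x + u / m * n) % n                   ≡⟨ [m+kn]%n≡m%n x (u / m) n ⟩
    x % n                                 ≡⟨ m<n⇒m%n≡m (m<n⇒m<1+n x<n′) ⟩
    x                                     ∎
    where open ≡-Reasoning

module _ {k₀ w : ℕ} where

  closeGap : ∀ {k} → k < k₀ ⊎ k₀ + w ≤ k → ℕ
  closeGap {k} (inj₁ _) = k
  closeGap {k} (inj₂ _) = k ∸ w

  closeGap-< : ∀ {k q} → k₀ + w ≤ q → k < q → (o : k < k₀ ⊎ k₀ + w ≤ k) → closeGap o < q ∸ w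
  closeGap-< k₀+w≤q k<q (inj₁ k<k₀)    = <-≤-trans k<k₀ (m+n≤o⇒m≤o∸n k₀ k₀+w≤q)
  closeGap-< k₀+w≤q k<q (inj₂ k₀+w≤k) = ∸-monoˡ-< k<q (≤-trans (m≤n+m w k₀) k₀+w≤k)

  closeGap-injective : ∀ {k l} (o : k < k₀ ⊎ k₀ + w ≤ k) (o′ : l < k₀ ⊎ k₀ + w ≤ l) →
                       closeGap o ≡ closeGap o′ → k ≡ l
  closeGap-injective (inj₁ _)    (inj₁ _)    eq = eq
  closeGap-injective (inj₁ k<k₀) (inj₂ k₀+w≤l) eq =
    contradiction (subst (k₀ ≤_) (sym eq) (m+n≤o⇒m≤o∸n k₀ k₀+w≤l)) (<⇒≱ k<k₀)
  closeGap-injective (inj₂ k₀+w≤k) (inj₁ l<k₀) eq =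
    contradiction (subst (k₀ ≤_) eq (m+n≤o⇒m≤o∸n k₀ k₀+w≤k)) (<⇒≱ l<k₀)
  closeGap-injective (inj₂ k₀+w≤k) (inj₂ k₀+w≤l) eq =
    ∸-cancelʳ-≡ (≤-trans (m≤n+m w k₀) k₀+w≤k) (≤-trans (m≤n+m w k₀) k₀+w≤l) eq

  injective-avoiding-gap : ∀ {n q} (f : ℕ → ℕ) → k₀ + w ≤ q →
    (∀ {i} → i < n → f i < q) → (∀ {i} → i < n → f i < k₀ ⊎ k₀ + w ≤ f i) →
    (∀ {i j} → i < j → j < n → f i ≢ f j) → n ≤ q ∸ w
  injective-avoiding-gap {n} {q} f k₀+w≤q f<q avoids injective with q ∸ w <? n
  ... | no  n≮q∸w = ≮⇒≥ n≮q∸w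
  ... | yes q∸w<n = contradiction (pigeonhole q∸w<n collapsed) no-collision
    where
    collapsed : Fin n → Fin (q ∸ w)
    collapsed i = fromℕ< (closeGap-< k₀+w≤q (f<q (toℕ<n i)) (avoids (toℕ<n i)))
    no-collision : ¬ ∃₂ λ i j → i Fin.< j × collapsed i ≡ collapsed j
    no-collision (i , j , i<j , same) = injective i<j (toℕ<n j)
      (closeGap-injective (avoids (toℕ<n i)) (avoids (toℕ<n j))
        (trans (sym (toℕ-fromℕ< _)) (trans (cong toℕ same) (toℕ-fromℕ< _))))

grid-point-in-window : ∀ {g} r t → r < g → ∃[ k ] t ≤ r + k * g × r + k * g < t + g
grid-point-in-window {g} r t r<g with least-witness (λ k → t ≤? r + k * g) {t} t≤r+t*g
  where
  instance _ = >-nonZero (≤-<-trans z≤n r<g)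
  t≤r+t*g : t ≤ r + t * g
  t≤r+t*g = ≤-trans (m≤m*n t g) (m≤n+m (t * g) r)
... | zero  , t≤r+0 , _     = 0 , t≤r+0 , subst (_< t + g) (sym (+-identityʳ r)) (<-≤-trans r<g (m≤n+m g t))
... | suc k , t≤ , below = suc k , t≤ , (begin-strict
  r + suc k * g    ≡⟨ solve 3 (λ r k g → r :+ (con 1 :+ k) :* g := (r :+ k :* g) :+ g) refl r k g ⟩
  (r + k * g) + g  <⟨ +-monoˡ-< g (≰⇒> (below ≤-refl)) ⟩
  t + g            ∎)
  where open ≤-Reasoning

grid-run-in-window : ∀ {r g t k₀ w B k} → t ≤ r + k₀ * g → r + k₀ * g < t + g → w * g ≤ B →
                     k₀ ≤ k → k < k₀ + w → t ≤ r + k * g × r + k * g < t + B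
grid-run-in-window {r} {g} {t} {k₀} {w} {B} {k} t≤ <t+g w*g≤B k₀≤k k<k₀+w =
  ≤-trans t≤ (+-monoʳ-≤ r (*-monoˡ-≤ g k₀≤k)) , +-cancelʳ-< g _ _ (begin-strict
    r + k * g + g          ≡⟨ solve 3 (λ r k g → r :+ k :* g :+ g := r :+ (con 1 :+ k) :* g) refl r k g ⟩
    r + suc k * g          ≤⟨ +-monoʳ-≤ r (*-monoˡ-≤ g k<k₀+w) ⟩
    r + (k₀ + w) * g       ≡⟨ solve 4 (λ r k₀ w g → r :+ (k₀ :+ w) :* g := (r :+ k₀ :* g) :+ w :* g)
                                      refl r k₀ w g ⟩
    (r + k₀ * g) + w * g   <⟨ +-mono-<-≤ <t+g w*g≤B ⟩
    t + g + B              ≡⟨ solve 3 (λ t g B → t :+ g :+ B := t :+ B :+ g) refl t g B ⟩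
    t + B + g              ∎)
  where open ≤-Reasoning

grid-run-fits : ∀ {r g t k₀ w B q} → r + k₀ * g < t + g → t + B ≤ q * g → w * g ≤ B → k₀ + w ≤ q
grid-run-fits {r} {g} {t} {k₀} {w} {B} {q} <t+g t+B≤q*g w*g≤B =
  s≤s⁻¹ (*-cancelʳ-< g (k₀ + w) (suc q) (begin-strict
  (k₀ + w) * g           ≡⟨ *-distribʳ-+ g k₀ w ⟩
  k₀ * g + w * g         ≤⟨ +-monoˡ-≤ (w * g) (m≤n+m (k₀ * g) r) ⟩
  (r + k₀ * g) + w * g   <⟨ +-mono-<-≤ <t+g w*g≤B ⟩
  t + g + B              ≡⟨ solve 3 (λ t g B → t :+ g :+ B := g :+ (t :+ B)) refl t g B ⟩
  g + (t + B)            ≤⟨ +-monoʳ-≤ g t+B≤q*g ⟩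
  suc q * g              ∎))
  where open ≤-Reasoning

record IsAdditiveOrder (M d q : ℕ) : Set where
  field
    positive    : 0 < q
    annihilates : M ∣ q * d
    minimal     : ∀ {k} → 0 < k → k < q → ¬ M ∣ k * d

  order≤ : ∀ {k} → 0 < k → M ∣ k * d → q ≤ k
  order≤ k>0 M∣kd = ≮⇒≥ λ k<q → minimal k>0 k<q M∣kd

  modulus≤order*d : 0 < d → M ≤ q * d
  modulus≤order*d d>0 = ∣⇒≤ ⦃ m*n≢0 q d ⦃ >-nonZero positive ⦄ ⦃ >-nonZero d>0 ⦄ ⦄ annihilates

  order∣modulus : q ∣ M
  order∣modulus = m%n≡0⇒n∣m M q remainder≡0
    where
    instance _ = >-nonZero positive
    M*d≡ : M * d ≡ (M / q) * (q * d) + (M % q) * d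
    M*d≡ = trans (cong (_* d) (m≡m%n+[m/n]*n M q))
             (solve 4 (λ r s q d → (r :+ s :* q) :* d := s :* (q :* d) :+ r :* d) refl (M % q) (M / q) q d)
    M∣remainder*d : M ∣ (M % q) * d
    M∣remainder*d = ∣m+n∣m⇒∣n (subst (M ∣_) M*d≡ (m∣m*n d)) (∣n⇒∣m*n (M / q) annihilates)
    remainder≡0 : M % q ≡ 0
    remainder≡0 with M % q in r≡
    ... | zero  = refl
    ... | suc r = contradiction (subst (λ z → M ∣ z * d) r≡ M∣remainder*d)
                    (minimal z<s (subst (_< q) r≡ (m%n<n M q)))

*-order≤ : ∀ {M d q n q′} → IsAdditiveOrder M d q → IsAdditiveOrder (n * M) d q′ → 0 < n → q′ ≤ n * q
*-order≤ {M} {d} {q} {n} ord ord′ n>0 = IsAdditiveOrder.order≤ ord′ (*-mono-≤ n>0 (IsAdditiveOrder.positive ord))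
  (subst (n * M ∣_) (sym (*-assoc n q d)) (*-monoʳ-∣ n (IsAdditiveOrder.annihilates ord)))

additiveOrder : ∀ M d → 0 < M → ∃ (IsAdditiveOrder M d)
additiveOrder M d M>0 with least-witness (λ k → (0 <? k) ×-dec (M ∣? k * d)) (M>0 , m∣m*n d)
... | q , (q>0 , M∣qd) , below = q , record
  { positive = q>0 ; annihilates = M∣qd ; minimal = λ k>0 k<q M∣kd → below k<q (k>0 , M∣kd) }

prime∣^⇒∣ : ∀ {p n} → Prime p → ∀ j → p ∣ n ^ j → p ∣ n
prime∣^⇒∣ pp zero    p∣1 = contradiction (∣1⇒≡1 p∣1) λ { refl → ¬prime[1] pp }
prime∣^⇒∣ {n = n} pp (suc j) p∣n^[1+j] with euclidsLemma n (n ^ j) pp p∣n^[1+j]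
... | inj₁ p∣n    = p∣n
... | inj₂ p∣n^j  = prime∣^⇒∣ pp j p∣n^j

prime∣∧∣∧prime∤⇒*∣ : ∀ {p m n} → Prime p → p ∣ n → m ∣ n → ¬ p ∣ m → p * m ∣ n
prime∣∧∣∧prime∤⇒*∣ {p} {m} pp p∣n (divides t refl) p∤m with euclidsLemma t m pp p∣n
... | inj₂ p∣m              = contradiction p∣m p∤m
... | inj₁ (divides s refl) = divides s (solve 3 (λ s p m → s :* p :* m := s :* (p :* m)) refl s p m)

product-increasing-primes∣ : ∀ {ps n} → AllPairs _<_ ps → All Prime ps → All (_∣ n) ps → product ps ∣ n
product-increasing-primes∣ []             []          []            = 1∣ _
product-increasing-primes∣ {p ∷ ps} (p<ps ∷ incr) (pp ∷ pps) (p∣n ∷ ps∣n) =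
  prime∣∧∣∧prime∤⇒*∣ pp p∣n (product-increasing-primes∣ incr pps ps∣n) p∤product
  where
  p∤product : ¬ p ∣ product ps
  p∤product p∣ps = <-irrefl refl (All.lookup p<ps (factorisationHasAllPrimeFactors pp p∣ps pps))

product∣^length : ∀ {ps n} → All (_∣ n) ps → product ps ∣ n ^ length ps
product∣^length []            = ∣-refl
product∣^length (p∣n ∷ ps∣n) = *-pres-∣ p∣n (product∣^length ps∣n)

primeDivisor? : ∀ m → Decidable (λ p → Prime p × p ∣ m)
primeDivisor? m p = prime? p ×-dec (p ∣? m)

primeDivisors : ℕ → List ℕ
primeDivisors m = filter (primeDivisor? m) (upTo (suc m))

primeDivisors-increasing : ∀ m → AllPairs _<_ (primeDivisors m)
primeDivisors-increasing m =
  AllPairs.filter⁺ (primeDivisor? m) (AllPairs.applyUpTo⁺₁ (λ i → i) (suc m) λ i<j _ → i<j)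

primeDivisors-prime∣ : ∀ m → All (λ p → Prime p × p ∣ m) (primeDivisors m)
primeDivisors-prime∣ m = all-filter (primeDivisor? m) (upTo (suc m))

∈-primeDivisors : ∀ {m p} .{{_ : NonZero m}} → Prime p → p ∣ m → p ∈ₗ primeDivisors m
∈-primeDivisors {m} pp p∣m = ∈-filter⁺ (primeDivisor? m) (∈-upTo⁺ (s≤s (∣⇒≤ p∣m))) (pp , p∣m)

rho∣ : ∀ {m n} → (∀ {p} → Prime p → p ∣ m → p ∣ n) → rho m ∣ n
rho∣ {m} H = product-increasing-primes∣ (primeDivisors-increasing m)
  (All.map proj₁ (primeDivisors-prime∣ m))
  (All.map (λ (pp , p∣m) → H pp p∣m) (primeDivisors-prime∣ m))

∣^⇒rho∣ : ∀ {m n} j → m ∣ n ^ j → rho m ∣ n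
∣^⇒rho∣ j m∣n^j = rho∣ λ pp p∣m → prime∣^⇒∣ pp j (∣-trans p∣m m∣n^j)

prime∣⇒∣rho : ∀ {m p} .{{_ : NonZero m}} → Prime p → p ∣ m → p ∣ rho m
prime∣⇒∣rho pp p∣m = ∈⇒∣product (∈-primeDivisors pp p∣m)

rho∣⇒∣^ : ∀ {m n} .{{_ : NonZero m}} → rho m ∣ n → ∃[ k ] m ∣ n ^ k
rho∣⇒∣^ {m} {n} rho∣n = length factors , subst (_∣ n ^ length factors) (sym isFactorisation)
  (product∣^length (All.zipWith (λ (pp , f∣m) → ∣-trans (prime∣⇒∣rho pp f∣m) rho∣n)
                                 (factorsPrime , factors∣m)))
  where
  open PrimeFactorisation (factorise m)
  factors∣m : All (_∣ m) factors
  factors∣m = All.tabulate λ f∈ → ∣-trans (∈⇒∣product f∈) (∣-reflexive (sym isFactorisation))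

betaUpTo-maximal : ∀ b k {m} → 1 ≤ m → m ≤ k → rho m ∣ b → m ≤ betaUpTo b k
betaUpTo-maximal b zero    1≤m m≤0 _ = contradiction (≤-trans 1≤m m≤0) λ ()
betaUpTo-maximal b (suc k) 1≤m m≤1+k rho∣b with rho (suc k) ∣? b
... | yes _ = m≤1+k
... | no rho[1+k]∤b with m≤n⇒m<n∨m≡n m≤1+k
...   | inj₁ m<1+k = betaUpTo-maximal b k 1≤m (s≤s⁻¹ m<1+k) rho∣b
...   | inj₂ refl  = contradiction rho∣b rho[1+k]∤b

betaUpTo-spec : ∀ b k → 1 ≤ k → rho (betaUpTo b k) ∣ b × 1 ≤ betaUpTo b k × betaUpTo b k ≤ k
betaUpTo-spec b (suc k) _ with rho (suc k) ∣? b
... | yes rho∣b = rho∣b , s≤s z≤n , ≤-refl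
betaUpTo-spec b 1             _ | no rho[1]∤b = contradiction (1∣ b) rho[1]∤b
betaUpTo-spec b (suc (suc k)) _ | no _ with betaUpTo-spec b (suc k) (s≤s z≤n)
... | rho∣b , 1≤β , β≤1+k = rho∣b , 1≤β , m≤n⇒m≤1+n β≤1+k

beta-spec : ∀ {b} → 2 ≤ b → rho (beta b) ∣ b × 1 ≤ beta b × beta b ≤ b ∸ 1
beta-spec {b} 2≤b = betaUpTo-spec b (b ∸ 1) (∸-monoˡ-≤ 1 2≤b)

≤beta : ∀ {b m} → 1 ≤ m → m < b → rho m ∣ b → m ≤ beta b
≤beta {b} 1≤m m<b = betaUpTo-maximal b (b ∸ 1) 1≤m (∸-monoˡ-≤ 1 m<b)

module Digits (b : ℕ) .{{_ : NonZero b}} where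

  shift≡/^ : ∀ n k → shift b n k ≡ _/_ n (b ^ k) ⦃ m^n≢0 b k ⦄
  shift≡/^ n zero    = sym (n/1≡n n)
  shift≡/^ n (suc k) = begin
    shift b n k / b   ≡⟨ cong (_/ b) (shift≡/^ n k) ⟩
    n / b ^ k / b     ≡⟨ m/n/o≡m/[n*o] n (b ^ k) b ⟩
    n / (b ^ k * b)   ≡⟨ /-congʳ (*-comm (b ^ k) b) ⟩
    n / b ^ suc k     ∎
    where
    open ≡-Reasoning
    instance _ = m^n≢0 b k
             _ = m^n≢0 b (suc k)
             _ = m*n≢0 (b ^ k) b

  module _ {m k i : ℕ} .{{_ : NonZero m}} (m∣b^k : m ∣ b ^ k) where

    high-digit-multiple≤ : ∀ {p} → k ≤ p → toℕ (digit b (i * (b ^ k / m)) p) ≤ i / m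
    high-digit-multiple≤ {p} k≤p = begin
      toℕ (digit b (i * (b ^ k / m)) p)  ≡⟨ toℕ-fromℕ< _ ⟩
      shift b (i * (b ^ k / m)) p % b    ≡⟨ cong (_% b) (trans (shift≡/^ _ p) quotient≡) ⟩
      i / m / b ^ e % b                  ≤⟨ m%n≤m _ b ⟩
      i / m / b ^ e                      ≤⟨ m/n≤m (i / m) (b ^ e) ⟩
      i / m                              ∎
      where
      open ≤-Reasoning
      e = p ∸ k
      instance _ = m^n≢0 b e
               _ = m^n≢0 b p
               _ = m^n≢0 b k
               _ = m*n≢0 m (b ^ e)
               _ = m*n≢0 m (b ^ p)
               _ = m*n≢0 (m * b ^ e) (b ^ k)
      m*b^p≡ : m * b ^ p ≡ (m * b ^ e) * b ^ k
      m*b^p≡ = begin-equality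
        m * b ^ p             ≡⟨ cong (λ t → m * b ^ t) (m+[n∸m]≡n k≤p) ⟨
        m * b ^ (k + e)       ≡⟨ cong (m *_) (^-distribˡ-+-* b k e) ⟩
        m * (b ^ k * b ^ e)   ≡⟨ solve 3 (λ m x y → m :* (x :* y) := (m :* y) :* x) refl m (b ^ k) (b ^ e) ⟩
        (m * b ^ e) * b ^ k   ∎
      quotient≡ : i * (b ^ k / m) / b ^ p ≡ i / m / b ^ e
      quotient≡ = begin-equality
        i * (b ^ k / m) / b ^ p            ≡⟨ cong (_/ b ^ p) (*-/-assoc i m∣b^k) ⟨
        i * b ^ k / m / b ^ p              ≡⟨ m/n/o≡m/[n*o] _ m (b ^ p) ⟩
        i * b ^ k / (m * b ^ p)            ≡⟨ /-congʳ m*b^p≡ ⟩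
        i * b ^ k / ((m * b ^ e) * b ^ k)  ≡⟨ m*n/o*n≡m/o i (b ^ k) (m * b ^ e) ⟩
        i / (m * b ^ e)                    ≡⟨ m/n/o≡m/[n*o] i m (b ^ e) ⟨
        i / m / b ^ e                      ∎

    low-digit-multiple<b∸1 : m < b → ∀ {p} → p < k → toℕ (digit b (i * (b ^ k / m)) p) < b ∸ 1
    low-digit-multiple<b∸1 m<b {p} p<k = subst (_< b ∸ 1) (sym digit≡) (*n/m%n<n∸1 (i * b ^ e) m<b)
      where
      open ≡-Reasoning
      e = k ∸ suc p
      instance _ = m^n≢0 b p
               _ = m*n≢0 m (b ^ p)
      b^k≡ : b ^ k ≡ b * b ^ p * b ^ e
      b^k≡ = trans (cong (b ^_) (sym (m+[n∸m]≡n p<k))) (^-distribˡ-+-* b (suc p) e)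
      digit≡ : toℕ (digit b (i * (b ^ k / m)) p) ≡ i * b ^ e * b / m % b
      digit≡ = begin
        toℕ (digit b (i * (b ^ k / m)) p)          ≡⟨ toℕ-fromℕ< _ ⟩
        shift b (i * (b ^ k / m)) p % b            ≡⟨ cong (_% b) (shift≡/^ _ p) ⟩
        i * (b ^ k / m) / b ^ p % b                ≡⟨ cong (λ t → t / b ^ p % b) (*-/-assoc i m∣b^k) ⟨
        i * b ^ k / m / b ^ p % b                  ≡⟨ cong (_% b) (m/n/o≡m/[n*o] _ m (b ^ p)) ⟩
        i * b ^ k / (m * b ^ p) % b                ≡⟨ cong (λ t → i * t / (m * b ^ p) % b) b^k≡ ⟩
        i * (b * b ^ p * b ^ e) / (m * b ^ p) % b  ≡⟨ cong (λ t → t / (m * b ^ p) % b)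
                                                       (solve 4 (λ i b x y → i :* (b :* x :* y) := i :* y :* b :* x)
                                                              refl i b (b ^ p) (b ^ e)) ⟩
        i * b ^ e * b * b ^ p / (m * b ^ p) % b    ≡⟨ cong (_% b) (m*n/o*n≡m/o (i * b ^ e * b) (b ^ p) m) ⟩
        i * b ^ e * b / m % b                      ∎

    digit-multiple<b∸1 : m < b → i < (b ∸ 1) * m → ∀ p → toℕ (digit b (i * (b ^ k / m)) p) < b ∸ 1
    digit-multiple<b∸1 m<b i<[b∸1]m p with ≤-<-connex k p
    ... | inj₁ k≤p = ≤-<-trans (high-digit-multiple≤ k≤p) (m<n*o⇒m/o<n i<[b∸1]m)
    ... | inj₂ p<k = low-digit-multiple<b∸1 m<b p<k

module LowerBound (b : ℕ) .{{_ : NonZero b}} (2≤b : 2 ≤ b) where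

  open Digits b

  b∸1<b : b ∸ 1 < b
  b∸1<b = ∸-monoʳ-< {b} {1} z<s (>-nonZero⁻¹ b)

  top : Fin b
  top = fromℕ< b∸1<b

  noTopDigit : Subset b
  noTopDigit = ∁ ⁅ top ⁆

  <b∸1⇒∈noTopDigit : ∀ {x} → toℕ x < b ∸ 1 → x ∈ noTopDigit
  <b∸1⇒∈noTopDigit {x} x<b∸1 = x∉p⇒x∈∁p (x≢y⇒x∉⁅y⁆ λ x≡top →
    <-irrefl (trans (cong toℕ x≡top) (toℕ-fromℕ< _)) x<b∸1)

  noTopDigit-permitted : Permitted b noTopDigit
  noTopDigit-permitted = (bottom , toℕ-fromℕ< 0<b , <b∸1⇒∈noTopDigit 0<b∸1)
                       , (top , x∈p⇒x∉∁p (x∈⁅x⁆ top))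
    where
    0<b = >-nonZero⁻¹ b
    bottom = fromℕ< 0<b
    0<b∸1 : toℕ bottom < b ∸ 1
    0<b∸1 = subst (_< b ∸ 1) (sym (toℕ-fromℕ< 0<b)) (∸-monoˡ-≤ 1 2≤b)

  beta-AP : HasAP b noTopDigit ((b ∸ 1) * beta b)
  beta-AP = 0 , b ^ k / β , step>0
          , λ i i<[b∸1]β p → <b∸1⇒∈noTopDigit (digit-multiple<b∸1 {k = k} β∣b^k β<b i<[b∸1]β p)
    where
    β = beta b
    β-spec = beta-spec 2≤b
    instance _ = >-nonZero (proj₁ (proj₂ β-spec))
    β<b : β < b
    β<b = ≤-<-trans (proj₂ (proj₂ β-spec)) b∸1<b
    k = proj₁ (rho∣⇒∣^ {β} (proj₁ β-spec))
    β∣b^k = proj₂ (rho∣⇒∣^ {β} (proj₁ β-spec))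
    step>0 : 0 < b ^ k / β
    step>0 = m≥n⇒m/n>0 ⦃ _ ⦄ (∣⇒≤ ⦃ m^n≢0 b k ⦄ β∣b^k)

module UpperBound (b : ℕ) .{{_ : NonZero b}} (2≤b : 2 ≤ b) where

  open Digits b

  module _ {d : ℕ} (d>0 : 0 < d) where

    order : ℕ → ℕ
    order J = proj₁ (additiveOrder (b ^ suc J) d (m^n>0 b (suc J)))

    isOrder : ∀ J → IsAdditiveOrder (b ^ suc J) d (order J)
    isOrder J = proj₂ (additiveOrder (b ^ suc J) d (m^n>0 b (suc J)))

    order[0]≤b : order 0 ≤ b
    order[0]≤b = IsAdditiveOrder.order≤ (isOrder 0) (>-nonZero⁻¹ b) (*-monoʳ-∣ b (1∣ d))

    b≤order[d] : b ≤ order d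
    b≤order[d] = ≮⇒≥ λ order<b → <⇒≱ (begin-strict
      order d * d     <⟨ *-monoˡ-< d ⦃ >-nonZero d>0 ⦄ order<b ⟩
      b * d           ≤⟨ *-monoʳ-≤ b (<⇒≤ (n<m^n 2≤b d)) ⟩
      b ^ suc d       ∎) (IsAdditiveOrder.modulus≤order*d (isOrder d) d>0)
      where open ≤-Reasoning

    order<b⇒≤beta : ∀ J → order J < b → order J ≤ beta b
    order<b⇒≤beta J order<b = ≤beta (IsAdditiveOrder.positive (isOrder J)) order<b
      (∣^⇒rho∣ (suc J) (IsAdditiveOrder.order∣modulus (isOrder J)))

    order-window : ∃[ J ] ∃[ q ] IsAdditiveOrder (b ^ suc J) d q × b ≤ q × q ≤ b * beta b
    order-window with b ≤? order 0
    ... | yes b≤order[0] = 0 , order 0 , isOrder 0 , b≤order[0]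
                         , ≤-trans order[0]≤b (subst (_≤ b * beta b) (*-identityʳ b) (*-monoʳ-≤ b 1≤β))
      where 1≤β = proj₁ (proj₂ (beta-spec 2≤b))
    ... | no  b≰order[0] with first-crossing (λ J → b ≤? order J) b≰order[0] {d} b≤order[d]
    ...   | J , b≰order[J] , b≤order[1+J] = suc J , order (suc J) , isOrder (suc J) , b≤order[1+J]
            , ≤-trans (*-order≤ (isOrder J) (isOrder (suc J)) (>-nonZero⁻¹ b))
                      (*-monoʳ-≤ b (order<b⇒≤beta J (≰⇒> b≰order[J])))

  module _ {S : Subset b} {c : Fin b} (c∉S : c ∉ S) {a d L : ℕ}
           (inK : ∀ i → i < L → InKempner b S (a + i * d)) where

    module AtLevel (J : ℕ) {q : ℕ} (ord : IsAdditiveOrder (b ^ suc J) d q) (b≤q : b ≤ q) where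

      open IsAdditiveOrder ord

      B M : ℕ
      B = b ^ J
      M = b ^ suc J

      instance
        B-nonZero : NonZero B
        B-nonZero = m^n≢0 b J
        M-nonZero : NonZero M
        M-nonZero = m^n≢0 b (suc J)
        q-nonZero : NonZero q
        q-nonZero = >-nonZero positive

      g : ℕ
      g = M / q

      g*q≡M : g * q ≡ M
      g*q≡M = m/n*n≡m order∣modulus

      instance
        g-nonZero : NonZero g
        g-nonZero = ≢-nonZero λ g≡0 → ≢-nonZero⁻¹ M (trans (sym g*q≡M) (cong (_* q) g≡0))

      g∣d : g ∣ d
      g∣d = *-cancelʳ-∣ q (subst (_∣ d * q) (sym g*q≡M) (subst (M ∣_) (*-comm q d) annihilates))

      g∣M : g ∣ M
      g∣M = divides q (trans (sym g*q≡M) (*-comm g q))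

      residue : ℕ → ℕ
      residue i = (a + i * d) % M

      r : ℕ
      r = a % g

      slot : ℕ → ℕ
      slot i = residue i / g

      residue≡ : ∀ i → residue i ≡ r + slot i * g
      residue≡ i = trans (m≡m%n+[m/n]*n (residue i) g) (cong (_+ slot i * g) residue%g≡r)
        where
        residue%g≡r : residue i % g ≡ r
        residue%g≡r = trans (m∣n⇒o%n%m≡o%m g M (a + i * d) g∣M) (%-remove-+ʳ a (∣n⇒∣m*n i g∣d))

      slot<q : ∀ i → slot i < q
      slot<q i = m<n*o⇒m/o<n (subst (residue i <_) (trans (sym g*q≡M) (*-comm g q)) (m%n<n (a + i * d) M))

      slot-injective : ∀ {i j} → i < j → j < q → slot i ≢ slot j
      slot-injective {i} {j} i<j j<q slot≡ = minimal (m<n⇒0<n∸m i<j) (≤-<-trans (m∸n≤m j i) j<q)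
        (subst (M ∣_) difference≡ (%≡%⇒∣∸ M residue-i≡residue-j))
        where
        residue-i≡residue-j : residue i ≡ residue j
        residue-i≡residue-j = trans (residue≡ i) (trans (cong (λ s → r + s * g) slot≡) (sym (residue≡ j)))
        difference≡ : (a + j * d) ∸ (a + i * d) ≡ (j ∸ i) * d
        difference≡ = trans ([m+n]∸[m+o]≡n∸o a (j * d) (i * d)) (sym (*-distribʳ-∸ d j i))

      residue-avoids-block : ∀ {i} → i < L → ¬ (toℕ c * B ≤ residue i × residue i < toℕ c * B + B)
      residue-avoids-block {i} i<L (lo , hi) = c∉S (subst (_∈ S) digit≡c (inK i i<L J))
        where
        digit≡c : digit b (a + i * d) J ≡ c
        digit≡c = toℕ-injective (begin
          toℕ (digit b (a + i * d) J)   ≡⟨ toℕ-fromℕ< _ ⟩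
          shift b (a + i * d) J % b     ≡⟨ cong (_% b) (shift≡/^ (a + i * d) J) ⟩
          (a + i * d) / B % b           ≡⟨ m%[n*o]/o≡m/o%n (a + i * d) b B ⟨
          residue i / B                 ≡⟨ c*n≤m<c*n+n⇒m/n≡c (toℕ c) lo hi ⟩
          toℕ c                         ∎)
          where open ≡-Reasoning

      w : ℕ
      w = B / g

      w*g≤B : w * g ≤ B
      w*g≤B = m/n*n≤m B g

      0<w : 0 < w
      0<w = m≥n⇒m/n>0 (*-cancelˡ-≤ b (begin
        b * g    ≡⟨ *-comm b g ⟩
        g * b    ≤⟨ *-monoʳ-≤ g b≤q ⟩
        g * q    ≡⟨ g*q≡M ⟩
        b * B    ∎))
        where open ≤-Reasoning

      q/b≤w : q / b ≤ w
      q/b≤w = ≤-trans (≤-reflexive (sym (m*n/n≡m (q / b) g)))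
                      (/-monoˡ-≤ g (*-cancelʳ-≤ (q / b * g) B b (begin
        q / b * g * b   ≡⟨ solve 3 (λ x g b → x :* g :* b := x :* b :* g) refl (q / b) g b ⟩
        q / b * b * g   ≤⟨ *-monoˡ-≤ g (m/n*n≤m q b) ⟩
        q * g           ≡⟨ trans (*-comm q g) g*q≡M ⟩
        b * B           ≡⟨ *-comm b B ⟩
        B * b           ∎)))
        where open ≤-Reasoning

      k₀ : ℕ
      k₀ = proj₁ (grid-point-in-window r (toℕ c * B) (m%n<n a g))

      k₀-lo : toℕ c * B ≤ r + k₀ * g
      k₀-lo = proj₁ (proj₂ (grid-point-in-window r (toℕ c * B) (m%n<n a g)))

      k₀-hi : r + k₀ * g < toℕ c * B + g
      k₀-hi = proj₂ (proj₂ (grid-point-in-window r (toℕ c * B) (m%n<n a g)))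

      slot-outside-gap : ∀ {i} → i < L → slot i < k₀ ⊎ k₀ + w ≤ slot i
      slot-outside-gap {i} i<L with slot i <? k₀ | slot i <? k₀ + w
      ... | yes slot<k₀ | _              = inj₁ slot<k₀
      ... | no  slot≮k₀ | yes slot<k₀+w = contradiction
              (subst (λ y → toℕ c * B ≤ y × y < toℕ c * B + B) (sym (residue≡ i))
                     (grid-run-in-window {r} {g} {k₀ = k₀} {w} k₀-lo k₀-hi w*g≤B (≮⇒≥ slot≮k₀) slot<k₀+w))
              (residue-avoids-block {i} i<L)
      ... | no  _       | no  slot≮k₀+w = inj₂ (≮⇒≥ slot≮k₀+w)

      gap-fits : k₀ + w ≤ q
      gap-fits = grid-run-fits {r} {g} {k₀ = k₀} {w} k₀-hi (begin
        toℕ c * B + B   ≡⟨ +-comm (toℕ c * B) B ⟩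
        suc (toℕ c) * B ≤⟨ *-monoˡ-≤ B (toℕ<n c) ⟩
        b * B           ≡⟨ trans (sym g*q≡M) (*-comm g q) ⟩
        q * g           ∎) w*g≤B
        where open ≤-Reasoning

      short-prefix≤q∸w : ∀ {n} → n ≤ L → n ≤ q → n ≤ q ∸ w
      short-prefix≤q∸w n≤L n≤q = injective-avoiding-gap slot gap-fits (λ {i} _ → slot<q i)
        (λ {i} i<n → slot-outside-gap {i} (<-≤-trans i<n n≤L))
        (λ i<j j<n → slot-injective i<j (<-≤-trans j<n n≤q))

      -- Slots are only known to be distinct among the first q terms, hence the case split.
      length≤q∸w : L ≤ q ∸ w
      length≤q∸w with L ≤? q
      ... | yes L≤q = short-prefix≤q∸w ≤-refl L≤q
      ... | no  L≰q = contradiction (short-prefix≤q∸w (<⇒≤ (≰⇒> L≰q)) ≤-refl)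
                        (<⇒≱ (∸-monoʳ-< 0<w (≤-trans (m≤n+m w k₀) gap-fits)))

      length≤ : L ≤ q ∸ q / b
      length≤ = ≤-trans length≤q∸w (∸-monoʳ-≤ q q/b≤w)

    upper-bound : 0 < d → L ≤ (b ∸ 1) * beta b
    upper-bound d>0 with order-window d>0
    ... | J , q , ord , b≤q , q≤b*β =
      ≤-trans (AtLevel.length≤ J ord b≤q) (m≤n*o⇒m∸m/n≤[n∸1]*o q b (beta b) q≤b*β)

theorem1p1 : (b : ℕ) .{{_ : NonZero b}} → 2 ≤ b → IsEll b ((b ∸ 1) * beta b)
theorem1p1 b 2≤b = (noTopDigit , noTopDigit-permitted , beta-AP) , bounded
  where
  open LowerBound b 2≤b
  open UpperBound b 2≤b
  bounded : ∀ S L → Permitted b S → HasAP b S L → L ≤ (b ∸ 1) * beta b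
  bounded S L (_ , c , c∉S) (a , d , d>0 , inK) = upper-bound c∉S inK d>0
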